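{- At any time during any sequence of operations on two-parent hollow heaps (as defined in the context), no root has a virtual parent.
   Context: Heaps. A heap stores a finite set of items, each with a key from a totally ordered universe, and supports: make-heap() (return an empty heap); find-min($h$) (return an item of minimum key in $h$, or null if $h$ is empty); insert($e,k,h$) (add item $e$, which is in no heap, with key $k$); delete-min($h$) (delete from non-empty $h$ the item that find-min($h$) returns); meld($h_1,h_2$) (return a heap containing all items of the item-disjoint heaps $h_1,h_2$); decrease-key($e,k,h$) (given an item $e$ in $h$ with key greater than $k$, change its key to $k$); delete($e,h$) (delete item $e$ from $h$). Heaps passed as arguments are destroyed; decrease-key and delete are given the location of $e$. Nodes. Nodes hold items: each node holds at most one item, and is full if it holds one and hollow otherwise; each item in a heap is held by exactly one node; a newly created node is full and a hollow node never becomes full again. Each node $u$ has a key $u.key$ (the current key of its item if $u$ is full; if $u$ is hollow, the key its item had just before leaving $u$) and a non-negative integer rank $u.rank$. A tree (or dag) of nodes with arcs from parent to child is heap-ordered if $v.key\le w.key$ for every arc $(v,w)$; a root is a node with no parent. For two full roots, link makes the one of larger key (ties broken arbitrarily) a child of the other; the new child is the loser and the other the winner. A ranked link is a link of two roots of equal rank and increases the winner's rank by one; an unranked link may be applied to any two full roots and changes no ranks. Two-parent hollow heap. It is either empty or a heap-ordered directed acyclic graph of nodes with one root, which is full; the root is the minimum node. make-heap returns an empty heap; find-min returns the item in the root; meld returns one heap if the other is empty, and otherwise does an unranked link of the two roots; insert($e,k,h$) creates a new full node of rank 0 holding $e$ with key $k$ and melds this one-node heap with $h$. decrease-key($e,k,h$),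 with $u$ the node holding $e$: if $u$ is the root one may simply set $u.key=k$; otherwise create a new node $v$, move $e$ from $u$ to $v$ (so $u$ becomes hollow), set $v.key=k$ and $v.rank=\max\{0,u.rank-2\}$, add the arc $(v,u)$ so that $u$ acquires $v$ as an additional parent (no children of $u$ are moved), and meld the one-node heap $v$ with the heap. delete($e,h$) removes $e$ from the node $u$ holding it, making $u$ hollow; if $u$ is not the root this completes the operation; otherwise, while some root is hollow, destroy such a root (removing its outgoing arcs, so that children left with no parent become roots); then do ranked links while two roots have equal rank; then do unranked links until one root remains. delete-min($h$) performs delete on the item in the root. Virtual parents (an analysis device, not part of the algorithm), defined along the execution: a newly created node has no virtual parent; when a root with no virtual parent loses a ranked link, the winner becomes its virtual parent; when the virtual parent of a node is destroyed, the node has no virtual parent; when a decrease-key moves an item from a node $u$ to a new node $v$, $v$ becomes the virtual parent of every node whose virtual parent is $u$ and whose rank is less than $v.rank=\max\{0,u.rank-2\}$. Otherwise virtual parents do not change. -}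

module Defs where

-- Operational model of two-parent hollow heaps, with virtual parents
-- (an analysis device) tracked alongside the algorithm's state.

open import Level using (Level; _⊔_)
open import Data.Nat using (ℕ; zero; suc; _≡ᵇ_; _<ᵇ_; _∸_; _≟_)
open import Data.Bool using (Bool; true; false; if_then_else_; _∧_)
open import Data.Maybe using (Maybe; just; nothing; _<∣>_)
import Data.Maybe as Maybe
open import Data.List using (List; []; _∷_; filter)
open import Data.List.Relation.Binary.Permutation.Propositional using (_↭_)
open import Data.List.Membership.Propositional using (_∈_)
open import Data.Product using (Σ; _×_; _,_)
open import Relation.Nullary using (¬_; ¬?)
open import Relation.Binary.PropositionalEquality using (_≡_; _≢_)
open import Relation.Binary.Bundles using (TotalOrder)
import Relation.Binary.Construct.NonStrictToStrict as NTS

module HollowHeaps {c ℓ₁ ℓ₂ : Level} (O : TotalOrder c ℓ₁ ℓ₂) where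

  open TotalOrder O renaming (Carrier to Key)

  _<K_ : Key → Key → Set (ℓ₁ ⊔ ℓ₂)
  _<K_ = NTS._<_ _≈_ _≤_

  -- Node identifiers are natural numbers (allocated freshly, never reused).
  --   full  : whether the node holds an item (hollow otherwise)
  --   pars  : the parents of the node (sources of arcs into it)
  --   vp    : its virtual parent, if any
  record Node : Set c where
    constructor mkNode
    field
      key  : Key
      rank : ℕ
      full : Bool
      pars : List ℕ
      vp   : Maybe ℕ
  open Node public

  -- The nodes of one heap: identifier ↦ node (nothing = not a node of this heap).
  Store : Set c
  Store = ℕ → Maybe Node

  emptyS : Store
  emptyS _ = nothing

  IsEmpty : Store → Set c
  IsEmpty h = ∀ i → h i ≡ nothing

  single : ℕ → Node → Store
  single u n i = if i ≡ᵇ u then just n else nothing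

  upd : Store → ℕ → Node → Store
  upd h u n i = if i ≡ᵇ u then just n else h i

  -- union of two heaps with disjoint node sets
  _∪S_ : Store → Store → Store
  (h₁ ∪S h₂) i = h₁ i <∣> h₂ i

  IsRoot : Store → ℕ → Node → Set c
  IsRoot h u n = (h u ≡ just n) × (pars n ≡ [])

  ulink : Store → ℕ → Node → ℕ → Node → Store
  ulink h w nw l nl = upd h l (record nl { pars = w ∷ pars nl })

  setVP : ℕ → Maybe ℕ → Maybe ℕ
  setVP w nothing  = just w
  setVP w (just x) = just x

  rlink : Store → ℕ → Node → ℕ → Node → Store
  rlink h w nw l nl =
    upd (upd h l (record nl { pars = w ∷ pars nl ; vp = setVP w (vp nl) }))
        w (record nw { rank = suc (rank nw) })

  data Meld : Store → Store → Store → Set (c ⊔ ℓ₂) where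
    meld-emptyˡ : ∀ {h₁ h₂} → IsEmpty h₁ → Meld h₁ h₂ h₂
    meld-emptyʳ : ∀ {h₁ h₂} → IsEmpty h₂ → Meld h₁ h₂ h₁
    meld-link₁  : ∀ {h₁ h₂ r₁ n₁ r₂ n₂} →
                  IsRoot h₁ r₁ n₁ → full n₁ ≡ true →
                  IsRoot h₂ r₂ n₂ → full n₂ ≡ true →
                  key n₁ ≤ key n₂ →
                  Meld h₁ h₂ (ulink (h₁ ∪S h₂) r₁ n₁ r₂ n₂)
    meld-link₂  : ∀ {h₁ h₂ r₁ n₁ r₂ n₂} →
                  IsRoot h₁ r₁ n₁ → full n₁ ≡ true →
                  IsRoot h₂ r₂ n₂ → full n₂ ≡ true →
                  key n₂ ≤ key n₁ →
                  Meld h₁ h₂ (ulink (h₁ ∪S h₂) r₂ n₂ r₁ n₁)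

  -- decrease-key, non-root case, at node u (record n), new node v, new key k:
  -- u becomes hollow and gains parent v; every node whose virtual parent is u
  -- and whose rank is below max{0, rank u - 2} gets v as virtual parent.
  moveVP : ℕ → ℕ → ℕ → Node → Node
  moveVP u v r w with vp w
  ... | nothing = w
  ... | just x  = if (x ≡ᵇ u) ∧ (rank w <ᵇ r) then record w { vp = just v } else w

  dkStore : Store → ℕ → Node → ℕ → Store
  dkStore h u n v =
    upd (λ i → Maybe.map (moveVP u v (rank n ∸ 2)) (h i))
        u (record (moveVP u v (rank n ∸ 2) n) { full = false ; pars = v ∷ pars n })

  clearVP : ℕ → Maybe ℕ → Maybe ℕ
  clearVP u nothing  = nothing
  clearVP u (just x) = if x ≡ᵇ u then nothing else just x

  clean : ℕ → Node → Node
  clean u n = record n { pars = filter (λ x → ¬? (x ≟ u)) (pars n) ; vp = clearVP u (vp n) }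

  destroy : Store → ℕ → Store
  destroy h u i = if i ≡ᵇ u then nothing else Maybe.map (clean u) (h i)

  -- phases of the clean-up after deleting the item of a root
  data Phase : Set where
    destroying ranking unranking : Phase

  -- global state: fresh-identifier counter, the current heaps, and (while a
  -- delete of a root item is in progress) the heap being cleaned up
  record State : Set c where
    constructor mkState
    field
      next  : ℕ
      heaps : List Store
      busy  : Maybe (Phase × Store)
  open State public

  init : State
  init = mkState 0 [] nothing

  newNode : Key → ℕ → Node
  newNode k r = mkNode k r true [] nothing

  -- one step: an operation (make-heap, insert, meld, decrease-key, delete,
  -- delete-min = delete of the root item), or one step of the clean-up of delete
  data Step : State → State → Set (c ⊔ ℓ₁ ⊔ ℓ₂) where
    make-heap : ∀ {m hs} → Step (mkState m hs nothing) (mkState m (emptyS ∷ hs) nothing)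
    insert    : ∀ {m hs h rest h'} (k : Key) →
                hs ↭ h ∷ rest →
                Meld (single m (newNode k 0)) h h' →
                Step (mkState m hs nothing) (mkState (suc m) (h' ∷ rest) nothing)
    meld      : ∀ {m hs h₁ h₂ rest h₃} →
                hs ↭ h₁ ∷ h₂ ∷ rest →
                Meld h₁ h₂ h₃ →
                Step (mkState m hs nothing) (mkState m (h₃ ∷ rest) nothing)
    dec-root  : ∀ {m hs h rest u n} (k : Key) →
                hs ↭ h ∷ rest →
                IsRoot h u n → full n ≡ true → k <K key n →
                Step (mkState m hs nothing)
                     (mkState m (upd h u (record n { key = k }) ∷ rest) nothing)
    dec-inner : ∀ {m hs h rest u n h'} (k : Key) →
                hs ↭ h ∷ rest →
                h u ≡ just n → pars n ≢ [] → full n ≡ true → k <K key n →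
                Meld (single m (newNode k (rank n ∸ 2))) (dkStore h u n m) h' →
                Step (mkState m hs nothing) (mkState (suc m) (h' ∷ rest) nothing)
    del-inner : ∀ {m hs h rest u n} →
                hs ↭ h ∷ rest →
                h u ≡ just n → pars n ≢ [] → full n ≡ true →
                Step (mkState m hs nothing)
                     (mkState m (upd h u (record n { full = false }) ∷ rest) nothing)
    del-root  : ∀ {m hs h rest u n} →
                hs ↭ h ∷ rest →
                IsRoot h u n → full n ≡ true →
                Step (mkState m hs nothing)
                     (mkState m rest (just (destroying , upd h u (record n { full = false }))))
    cl-destroy : ∀ {m hs h u n} →
                IsRoot h u n → full n ≡ false →
                Step (mkState m hs (just (destroying , h)))
                     (mkState m hs (just (destroying , destroy h u)))
    cl-to-rank : ∀ {m hs h} →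
                (∀ u n → IsRoot h u n → full n ≡ true) →
                Step (mkState m hs (just (destroying , h)))
                     (mkState m hs (just (ranking , h)))
    cl-rlink  : ∀ {m hs h w nw l nl} →
                IsRoot h w nw → full nw ≡ true →
                IsRoot h l nl → full nl ≡ true →
                w ≢ l → rank nw ≡ rank nl → key nw ≤ key nl →
                Step (mkState m hs (just (ranking , h)))
                     (mkState m hs (just (ranking , rlink h w nw l nl)))
    cl-to-unrank : ∀ {m hs h} →
                (∀ u nu v nv → IsRoot h u nu → IsRoot h v nv → u ≢ v → rank nu ≢ rank nv) →
                Step (mkState m hs (just (ranking , h)))
                     (mkState m hs (just (unranking , h)))
    cl-ulink  : ∀ {m hs h w nw l nl} →
                IsRoot h w nw → full nw ≡ true →
                IsRoot h l nl → full nl ≡ true →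
                w ≢ l → key nw ≤ key nl →
                Step (mkState m hs (just (unranking , h)))
                     (mkState m hs (just (unranking , ulink h w nw l nl)))
    cl-done   : ∀ {m hs h} →
                (∀ u nu v nv → IsRoot h u nu → IsRoot h v nv → u ≡ v) →
                Step (mkState m hs (just (unranking , h)))
                     (mkState m (h ∷ hs) nothing)

  data Reachable : State → Set (c ⊔ ℓ₁ ⊔ ℓ₂) where
    start : Reachable init
    step  : ∀ {s s'} → Reachable s → Step s s' → Reachable s'

  data StoreOf : State → Store → Set c where
    in-heaps : ∀ {s h} → h ∈ heaps s → StoreOf s h
    in-busy  : ∀ {s p h} → busy s ≡ just (p , h) → StoreOf s h

  NoRootHasVP : State → Set c
  NoRootHasVP s = ∀ h u n → StoreOf s h → IsRoot h u n → vp n ≡ nothing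

-- Every virtual parent is a proper ancestor of its node along parent arcs.
-- A ranked link gives the loser its winner both as a parent and as virtual
-- parent; a decrease-key moving an item from u to v makes v a parent of u,
-- so nodes whose virtual parent moves from u to v still reach it; destroying
-- a root u removes only paths that end at u, since u has no parents, and the
-- nodes whose virtual parent was u lose it. Arcs are otherwise only added, so
-- the invariant is preserved, and a root, having no ancestor, has no virtual
-- parent. Melds need the heaps to have disjoint node sets, which holds because
-- new nodes are allocated from a fresh counter.
module Submission where

open import Defs
open import Level using (Level)
open import Relation.Binary.Bundles using (TotalOrder)

open import Data.Bool using (true; false; if_then_else_; _∧_; T)
open import Data.Empty using (⊥-elim)
open import Data.List using (List; []; _∷_)
open import Data.List.Membership.Propositional using (_∈_; _∉_)
open import Data.List.Membership.Propositional.Properties using (∈-filter⁺)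
open import Data.List.Relation.Binary.Permutation.Propositional using (_↭_; ↭⇒↭ₛ)
open import Data.List.Relation.Binary.Permutation.Propositional.Properties using (All-resp-↭)
import Data.List.Relation.Binary.Permutation.Setoid.Properties as Permutationₛ
open import Data.List.Relation.Binary.Subset.Propositional using (_⊆_)
open import Data.List.Relation.Unary.All using (All; []; _∷_)
import Data.List.Relation.Unary.All as All
open import Data.List.Relation.Unary.AllPairs using (AllPairs; []; _∷_)
open import Data.List.Relation.Unary.Any using (here; there)
open import Data.List.Relation.Unary.Any.Properties using (¬Any[])
open import Data.Maybe using (just; nothing)
import Data.Maybe as Maybe
open import Data.Maybe.Properties using (just-injective)
open import Data.Nat using (ℕ; suc; _≡ᵇ_; _<ᵇ_; _∸_; _≟_; _≤_; _<_)
open import Data.Nat.Properties using (≡ᵇ⇒≡; ≡⇒≡ᵇ; ≤-refl; ≤-trans; n≤1+n; <⇒≢; >⇒≢; <⇒≤; ≮⇒≥; _<?_)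
open import Data.Product using (∃-syntax; _×_; _,_; proj₁; proj₂; uncurry)
open import Data.Sum using (_⊎_; inj₁; inj₂)
open import Data.Unit using (tt)
open import Function using (id; _∘_; case_of_)
open import Relation.Nullary using (¬_; ¬?; yes; no)
open import Relation.Binary.PropositionalEquality
  using (_≡_; _≢_; refl; sym; trans; cong; subst; resp₂; setoid)

if-≡ᵇ : ∀ {a} {A : Set a} (i u : ℕ) (x y : A) →
        (i ≡ u × (if i ≡ᵇ u then x else y) ≡ x) ⊎ (i ≢ u × (if i ≡ᵇ u then x else y) ≡ y)
if-≡ᵇ i u x y with i ≡ᵇ u in eq
... | true  = inj₁ (≡ᵇ⇒≡ i u (subst T (sym eq) tt) , refl)
... | false = inj₂ ((λ i≡u → subst T eq (≡⇒≡ᵇ i u i≡u)) , refl)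

module VirtualParents {c ℓ₁ ℓ₂ : Level} (O : TotalOrder c ℓ₁ ℓ₂) where
  open HollowHeaps O

  private
    variable
      h h' h₁ h₂ h₃ : Store
      u v w x i m : ℕ
      n n' nw : Node

  data Ancestor (h : Store) (x : ℕ) : ℕ → Set c where
    parent : h w ≡ just nw → x ∈ pars nw → Ancestor h x w
    via    : h w ≡ just nw → v ∈ pars nw → Ancestor h x v → Ancestor h x w

  root-parentless : IsRoot h u n → h u ≡ just n' → x ∉ pars n'
  root-parentless (hu , no-pars) hu' with just-injective (trans (sym hu) hu')
  ... | refl = ¬Any[] ∘ subst (_ ∈_) no-pars

  root-has-no-ancestor : IsRoot h u n → ¬ Ancestor h x u
  root-has-no-ancestor {h} root (parent hu x∈) = root-parentless {h} root hu x∈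
  root-has-no-ancestor {h} root (via hu v∈ _)  = root-parentless {h} root hu v∈

  Ancestor-trans-parent : Ancestor h u w → h u ≡ just n → v ∈ pars n → Ancestor h v w
  Ancestor-trans-parent (parent hw u∈) hu v∈   = via hw u∈ (parent hu v∈)
  Ancestor-trans-parent (via hw p∈ anc) hu v∈  = via hw p∈ (Ancestor-trans-parent anc hu v∈)

  _⊑_ : Store → Store → Set c
  h ⊑ h' = ∀ {w nw} → h w ≡ just nw → ∃[ nw' ] h' w ≡ just nw' × pars nw ⊆ pars nw'

  Ancestor-⊑ : h ⊑ h' → Ancestor h x w → Ancestor h' x w
  Ancestor-⊑ h⊑h' (parent hw x∈) with h⊑h' hw
  ... | _ , h'w , pars⊆ = parent h'w (pars⊆ x∈)
  Ancestor-⊑ h⊑h' (via hw v∈ anc) with h⊑h' hw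
  ... | _ , h'w , pars⊆ = via h'w (pars⊆ v∈) (Ancestor-⊑ h⊑h' anc)

  Ancestral : Store → Set c
  Ancestral h = ∀ {w nw x} → h w ≡ just nw → vp nw ≡ just x → Ancestor h x w

  Ancestral⇒root-vp≡nothing : Ancestral h → IsRoot h u n → vp n ≡ nothing
  Ancestral⇒root-vp≡nothing {n = n} anc root with vp n in vp≡
  ... | nothing = refl
  ... | just x  = ⊥-elim (root-has-no-ancestor root (anc (proj₁ root) vp≡))

  _⊆ᴺ_ : Store → Store → Set c
  h' ⊆ᴺ h = ∀ i → h i ≡ nothing → h' i ≡ nothing

  ⊆ᴺ-trans : h₃ ⊆ᴺ h₂ → h₂ ⊆ᴺ h₁ → h₃ ⊆ᴺ h₁
  ⊆ᴺ-trans h₃⊆h₂ h₂⊆h₁ i = h₃⊆h₂ i ∘ h₂⊆h₁ i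

  upd-≢ : i ≢ u → upd h u n i ≡ h i
  upd-≢ {i} {u} {h} {n} i≢u with if-≡ᵇ i u (just n) (h i)
  ... | inj₁ (i≡u , _) = ⊥-elim (i≢u i≡u)
  ... | inj₂ (_ , e)   = e

  upd-⊆ᴺ : h u ≡ just n → upd h u n' ⊆ᴺ h
  upd-⊆ᴺ {h} {u} {n' = n'} hu i hi with if-≡ᵇ i u (just n') (h i)
  ... | inj₁ (refl , _) = case trans (sym hi) hu of λ ()
  ... | inj₂ (_ , e)    = trans e hi

  upd-⊑ : h u ≡ just n → pars n ⊆ pars n' → h ⊑ upd h u n'
  upd-⊑ {h} {u} {n' = n'} hu pars⊆ {w} hw with if-≡ᵇ w u (just n') (h w)
  ... | inj₂ (_ , e) = _ , trans e hw , id
  ... | inj₁ (refl , e) with trans (sym hu) hw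
  ... | refl = n' , e , pars⊆

  upd-ancestral : Ancestral h → h u ≡ just n → pars n ⊆ pars n' →
                  (∀ {x} → vp n' ≡ just x → vp n ≡ just x ⊎ x ∈ pars n') →
                  Ancestral (upd h u n')
  upd-ancestral {h} {u} {n' = n'} anc hu pars⊆ vp-new {w} hw vx with if-≡ᵇ w u (just n') (h w)
  ... | inj₂ (_ , e) = Ancestor-⊑ (upd-⊑ {h} hu pars⊆) (anc (trans (sym e) hw) vx)
  ... | inj₁ (refl , e) with trans (sym e) hw
  ... | refl with vp-new vx
  ...   | inj₁ vn = Ancestor-⊑ (upd-⊑ {h} hu pars⊆) (anc hu vn)
  ...   | inj₂ x∈ = parent e x∈

  ulink-ancestral : ∀ {nl} → Ancestral h → h v ≡ just nl → Ancestral (ulink h w nw v nl)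
  ulink-ancestral anc hv = upd-ancestral anc hv there inj₁

  setVP-just : ∀ mv → setVP w mv ≡ just x → mv ≡ just x ⊎ x ≡ w
  setVP-just nothing  refl = inj₂ refl
  setVP-just (just _) e    = inj₁ e

  rlink-ancestral : ∀ {nl} → Ancestral h → h w ≡ just nw → h v ≡ just nl → w ≢ v →
                    Ancestral (rlink h w nw v nl)
  rlink-ancestral {h} {w} {nw} {v} {nl} anc hw hv w≢v =
    upd-ancestral (upd-ancestral anc hv there loser-vp) (trans (upd-≢ {h = h} w≢v) hw) id inj₁
    where
    loser-vp : ∀ {x} → setVP w (vp nl) ≡ just x → vp nl ≡ just x ⊎ x ∈ w ∷ pars nl
    loser-vp e with setVP-just (vp nl) e
    ... | inj₁ vl   = inj₁ vl
    ... | inj₂ refl = inj₂ (here refl)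

  rlink-⊆ᴺ : ∀ {nl} → h w ≡ just nw → h v ≡ just nl → w ≢ v → rlink h w nw v nl ⊆ᴺ h
  rlink-⊆ᴺ {h} hw hv w≢v = ⊆ᴺ-trans (upd-⊆ᴺ (trans (upd-≢ {h = h} w≢v) hw)) (upd-⊆ᴺ {h} hv)

  single-≢ : ∀ {nd} → i ≢ m → single m nd i ≡ nothing
  single-≢ {i} {m} {nd} i≢m with if-≡ᵇ i m (just nd) nothing
  ... | inj₁ (i≡m , _) = ⊥-elim (i≢m i≡m)
  ... | inj₂ (_ , e)   = e

  single-ancestral : ∀ {nd} → vp nd ≡ nothing → Ancestral (single m nd)
  single-ancestral {m} {nd} vp≡ {w} hw vx with if-≡ᵇ w m (just nd) nothing
  ... | inj₂ (_ , e) = case trans (sym e) hw of λ ()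
  ... | inj₁ (_ , e) with trans (sym e) hw
  ... | refl = case trans (sym vp≡) vx of λ ()

  Disjoint : Store → Store → Set c
  Disjoint h₁ h₂ = ∀ i → h₁ i ≡ nothing ⊎ h₂ i ≡ nothing

  Disjoint-sym : Disjoint h₁ h₂ → Disjoint h₂ h₁
  Disjoint-sym disj i with disj i
  ... | inj₁ e = inj₂ e
  ... | inj₂ e = inj₁ e

  ∪S-inˡ : h₁ i ≡ just n → (h₁ ∪S h₂) i ≡ just n
  ∪S-inˡ h₁i rewrite h₁i = refl

  ∪S-inʳ : Disjoint h₁ h₂ → h₂ i ≡ just n → (h₁ ∪S h₂) i ≡ just n
  ∪S-inʳ {i = i} disj h₂i with disj i
  ... | inj₁ h₁i rewrite h₁i = h₂i
  ... | inj₂ h₂i′ = case trans (sym h₂i′) h₂i of λ ()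

  ∪S-nothing : h₁ i ≡ nothing → h₂ i ≡ nothing → (h₁ ∪S h₂) i ≡ nothing
  ∪S-nothing h₁i h₂i rewrite h₁i = h₂i

  ∪S-nothing⁻ : (h₁ ∪S h₂) i ≡ nothing → h₁ i ≡ nothing × h₂ i ≡ nothing
  ∪S-nothing⁻ {h₁} {h₂} {i} e with h₁ i | h₂ i
  ... | nothing | nothing = refl , refl

  ∪S-ancestral : Disjoint h₁ h₂ → Ancestral h₁ → Ancestral h₂ → Ancestral (h₁ ∪S h₂)
  ∪S-ancestral {h₁} {h₂} disj anc₁ anc₂ {w} hw vx with h₁ w in h₁w
  ... | just n₁ with hw
  ... | refl = Ancestor-⊑ (λ h₁v → _ , ∪S-inˡ {h₁} {h₂ = h₂} h₁v , id) (anc₁ h₁w vx)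
  ∪S-ancestral {h₁} {h₂} disj anc₁ anc₂ {w} hw vx | nothing =
    Ancestor-⊑ (λ h₂v → _ , ∪S-inʳ disj h₂v , id) (anc₂ hw vx)

  Meld-ancestral : Disjoint h₁ h₂ → Ancestral h₁ → Ancestral h₂ → Meld h₁ h₂ h₃ → Ancestral h₃
  Meld-ancestral disj anc₁ anc₂ (meld-emptyˡ _) = anc₂
  Meld-ancestral disj anc₁ anc₂ (meld-emptyʳ _) = anc₁
  Meld-ancestral {h₁} {h₂} disj anc₁ anc₂ (meld-link₁ {n₁ = n₁} _ _ (h₂r , _) _ _) =
    ulink-ancestral {nw = n₁} (∪S-ancestral disj anc₁ anc₂) (∪S-inʳ {h₁} disj h₂r)
  Meld-ancestral {h₁} {h₂} disj anc₁ anc₂ (meld-link₂ {n₂ = n₂} (h₁r , _) _ _ _ _) =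
    ulink-ancestral {nw = n₂} (∪S-ancestral disj anc₁ anc₂) (∪S-inˡ {h₁} {h₂ = h₂} h₁r)

  Meld-⊆ᴺ : Disjoint h₁ h₂ → Meld h₁ h₂ h₃ → h₃ ⊆ᴺ (h₁ ∪S h₂)
  Meld-⊆ᴺ {h₁} {h₂} disj (meld-emptyˡ _) i = proj₂ ∘ ∪S-nothing⁻ {h₁} {h₂ = h₂}
  Meld-⊆ᴺ {h₁} {h₂} disj (meld-emptyʳ _) i = proj₁ ∘ ∪S-nothing⁻ {h₁} {h₂ = h₂}
  Meld-⊆ᴺ {h₁} {h₂} disj (meld-link₁ _ _ (h₂r , _) _ _) = upd-⊆ᴺ {h₁ ∪S h₂} (∪S-inʳ {h₁} disj h₂r)
  Meld-⊆ᴺ {h₁} {h₂} disj (meld-link₂ (h₁r , _) _ _ _ _) = upd-⊆ᴺ {h₁ ∪S h₂} (∪S-inˡ {h₁} {h₂ = h₂} h₁r)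

  pars-moveVP : ∀ r nd → pars (moveVP u v r nd) ≡ pars nd
  pars-moveVP {u} {v} r nd with vp nd
  ... | nothing = refl
  ... | just y with (y ≡ᵇ u) ∧ (rank nd <ᵇ r)
  ...   | true  = refl
  ...   | false = refl

  vp-moveVP : ∀ r nd → vp (moveVP u v r nd) ≡ just x → vp nd ≡ just x ⊎ (vp nd ≡ just u × x ≡ v)
  vp-moveVP {u} {v} r nd with vp nd in vp≡
  ... | nothing = inj₁ ∘ trans (sym vp≡)
  ... | just y with y ≡ᵇ u in y≡ᵇu
  ...   | false = inj₁ ∘ trans (sym vp≡)
  ...   | true with rank nd <ᵇ r
  ...     | false = inj₁ ∘ trans (sym vp≡)
  ...     | true  = λ { refl → inj₂ (cong just (≡ᵇ⇒≡ y u (subst T (sym y≡ᵇu) tt)) , refl) }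

  module DecreaseKey (h : Store) (u : ℕ) (n : Node) (v : ℕ) (hu : h u ≡ just n) where
    move : Node → Node
    move = moveVP u v (rank n ∸ 2)

    hollowed : Node
    hollowed = record (move n) { full = false ; pars = v ∷ pars n }

    dkStore-u : dkStore h u n v u ≡ just hollowed
    dkStore-u with if-≡ᵇ u u (just hollowed) (Maybe.map move (h u))
    ... | inj₁ (_ , e)   = e
    ... | inj₂ (u≢u , _) = ⊥-elim (u≢u refl)

    dkStore-⊑ : h ⊑ dkStore h u n v
    dkStore-⊑ {w} hw with if-≡ᵇ w u (just hollowed) (Maybe.map move (h w))
    ... | inj₁ (refl , e) with trans (sym hu) hw
    ... | refl = hollowed , e , there
    dkStore-⊑ {w} {nw} hw | inj₂ (_ , e) =
      move nw , trans e (cong (Maybe.map move) hw) , subst (_ ∈_) (sym (pars-moveVP _ nw))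

    -- A virtual parent moved from u to v stays an ancestor, through the new arc (v, u).
    moved-ancestor : Ancestral h → h w ≡ just nw → vp nw ≡ just u →
                     Ancestor (dkStore h u n v) v w
    moved-ancestor anc hw vw =
      Ancestor-trans-parent (Ancestor-⊑ dkStore-⊑ (anc hw vw)) dkStore-u (here refl)

    dkStore-ancestral : Ancestral h → Ancestral (dkStore h u n v)
    dkStore-ancestral anc {w} hw vx with if-≡ᵇ w u (just hollowed) (Maybe.map move (h w))
    ... | inj₁ (refl , e) with trans (sym e) hw
    ... | refl with vp-moveVP _ n vx
    ...   | inj₁ vn          = Ancestor-⊑ dkStore-⊑ (anc hu vn)
    ...   | inj₂ (vn , refl) = moved-ancestor anc hu vn
    dkStore-ancestral anc {w} hw vx | inj₂ (_ , e) with h w in hw′ | trans (sym e) hw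
    ... | just nd | refl with vp-moveVP _ nd vx
    ...   | inj₁ vd          = Ancestor-⊑ dkStore-⊑ (anc hw′ vd)
    ...   | inj₂ (vd , refl) = moved-ancestor anc hw′ vd

    dkStore-⊆ᴺ : dkStore h u n v ⊆ᴺ h
    dkStore-⊆ᴺ i hi with if-≡ᵇ i u (just hollowed) (Maybe.map move (h i))
    ... | inj₁ (refl , _) = case trans (sym hi) hu of λ ()
    ... | inj₂ (_ , e)    = trans e (cong (Maybe.map move) hi)

  clearVP-just : ∀ mv → clearVP u mv ≡ just x → mv ≡ just x × x ≢ u
  clearVP-just {u} (just y) e with if-≡ᵇ y u nothing (just y)
  ... | inj₁ (_ , e′) = case trans (sym e′) e of λ ()
  ... | inj₂ (y≢u , e′) with trans (sym e′) e
  ... | refl = refl , y≢u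

  destroy-≢ : i ≢ u → destroy h u i ≡ Maybe.map (clean u) (h i)
  destroy-≢ {i} {u} {h} i≢u with if-≡ᵇ i u nothing (Maybe.map (clean u) (h i))
  ... | inj₁ (i≡u , _) = ⊥-elim (i≢u i≡u)
  ... | inj₂ (_ , e)   = e

  destroy-just : w ≢ u → h w ≡ just nw → destroy h u w ≡ just (clean u nw)
  destroy-just {u = u} {h} w≢u hw = trans (destroy-≢ {h = h} w≢u) (cong (Maybe.map (clean u)) hw)

  ∈-pars-clean : x ≢ u → x ∈ pars n → x ∈ pars (clean u n)
  ∈-pars-clean {u = u} x≢u x∈ = ∈-filter⁺ (λ y → ¬? (y ≟ u)) x∈ x≢u

  -- A path from w up to x avoids the root u unless it ends there.
  Ancestor-destroy : IsRoot h u n → Ancestor h x w → x ≢ u → w ≢ u → Ancestor (destroy h u) x w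
  Ancestor-destroy {h} root (parent {nw = nw} hw x∈) x≢u w≢u =
    parent (destroy-just {h = h} w≢u hw) (∈-pars-clean {n = nw} x≢u x∈)
  Ancestor-destroy {h} {u} root (via {nw = nw} hw v∈ anc) x≢u w≢u =
    via (destroy-just {h = h} w≢u hw) (∈-pars-clean {n = nw} v≢u v∈) (Ancestor-destroy root anc x≢u v≢u)
    where
    v≢u : _ ≢ u
    v≢u refl = root-has-no-ancestor root anc

  destroy-ancestral : Ancestral h → IsRoot h u n → Ancestral (destroy h u)
  destroy-ancestral {h} {u} anc root {w} hw vx with if-≡ᵇ w u nothing (Maybe.map (clean u) (h w))
  ... | inj₁ (_ , e) = case trans (sym e) hw of λ ()
  ... | inj₂ (w≢u , e) with h w in hw′ | trans (sym e) hw
  ... | just nd | refl with clearVP-just (vp nd) vx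
  ... | vd , x≢u = Ancestor-destroy root (anc hw′ vd) x≢u w≢u

  destroy-⊆ᴺ : destroy h u ⊆ᴺ h
  destroy-⊆ᴺ {h} {u} i hi with if-≡ᵇ i u nothing (Maybe.map (clean u) (h i))
  ... | inj₁ (_ , e) = e
  ... | inj₂ (_ , e) = trans e (cong (Maybe.map (clean u)) hi)

  Fresh : ℕ → Store → Set c
  Fresh m h = ∀ {i} → m ≤ i → h i ≡ nothing

  Fresh-mono : ∀ {m'} → m ≤ m' → Fresh m h → Fresh m' h
  Fresh-mono m≤m' fresh m'≤i = fresh (≤-trans m≤m' m'≤i)

  record Wellformed (m : ℕ) (hs : List Store) : Set c where
    field
      disjoint  : AllPairs Disjoint hs
      fresh     : All (Fresh m) hs
      ancestral : All Ancestral hs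
  open Wellformed

  Wellformed-↭ : ∀ {hs hs'} → Wellformed m hs → hs ↭ hs' → Wellformed m hs'
  Wellformed-↭ wf p = record
    { disjoint  = Permutationₛ.AllPairs-resp-↭ (setoid Store) Disjoint-sym (resp₂ Disjoint) (↭⇒↭ₛ p) (disjoint wf)
    ; fresh     = All-resp-↭ p (fresh wf)
    ; ancestral = All-resp-↭ p (ancestral wf)
    }

  Disjoint-replace : ∀ {g} → (∀ {i} → i < m → h i ≡ nothing → h' i ≡ nothing) → Fresh m g →
                     Disjoint h g → Disjoint h' g
  Disjoint-replace {m} below fresh-g disj i with disj i | i <? m
  ... | inj₂ gi | _       = inj₂ gi
  ... | inj₁ hi | yes i<m = inj₁ (below i<m hi)
  ... | inj₁ _  | no i≮m  = inj₂ (fresh-g (≮⇒≥ i≮m))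

  Disjoint-∪S : ∀ {g} → Disjoint h₁ g → Disjoint h₂ g → Disjoint (h₁ ∪S h₂) g
  Disjoint-∪S {h₁} {h₂} disj₁ disj₂ i with disj₁ i | disj₂ i
  ... | inj₂ gi | _       = inj₂ gi
  ... | _       | inj₂ gi = inj₂ gi
  ... | inj₁ h₁i | inj₁ h₂i = inj₁ (∪S-nothing {h₁} {h₂ = h₂} h₁i h₂i)

  Wellformed-replace : ∀ {m' hs} → m ≤ m' → Wellformed m (h ∷ hs) →
                       (∀ {i} → i < m → h i ≡ nothing → h' i ≡ nothing) → Fresh m' h' → Ancestral h' →
                       Wellformed m' (h' ∷ hs)
  Wellformed-replace m≤m' wf below fresh' anc' with disjoint wf | fresh wf | ancestral wf
  ... | d ∷ ds | _ ∷ fs | _ ∷ as = record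
    { disjoint  = All.zipWith (uncurry (Disjoint-replace below)) (fs , d) ∷ ds
    ; fresh     = fresh' ∷ All.map (Fresh-mono m≤m') fs
    ; ancestral = anc' ∷ as
    }

  Wellformed-shrink : ∀ {hs} → Wellformed m (h ∷ hs) → h' ⊆ᴺ h → Ancestral h' → Wellformed m (h' ∷ hs)
  Wellformed-shrink wf h'⊆h =
    Wellformed-replace ≤-refl wf (λ {i} _ → h'⊆h i) (λ {i} m≤i → h'⊆h i (All.head (fresh wf) m≤i))

  Wellformed-upd : ∀ {hs} → Wellformed m (h ∷ hs) → h u ≡ just n → pars n ⊆ pars n' →
                   (∀ {x} → vp n' ≡ just x → vp n ≡ just x ⊎ x ∈ pars n') →
                   Wellformed m (upd h u n' ∷ hs)
  Wellformed-upd {h = h} wf hu pars⊆ vp-new =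
    Wellformed-shrink wf (upd-⊆ᴺ {h} hu) (upd-ancestral (All.head (ancestral wf)) hu pars⊆ vp-new)

  Wellformed-meld : ∀ {hs} → Wellformed m (h₁ ∷ h₂ ∷ hs) → Meld h₁ h₂ h₃ → Wellformed m (h₃ ∷ hs)
  Wellformed-meld {m} {h₁} {h₂} {hs = hs} wf me with disjoint wf | fresh wf | ancestral wf
  ... | (d₁₂ ∷ d₁) ∷ d₂ ∷ ds | f₁ ∷ f₂ ∷ fs | a₁ ∷ a₂ ∷ as =
    Wellformed-shrink union (Meld-⊆ᴺ d₁₂ me) (Meld-ancestral d₁₂ a₁ a₂ me)
    where
    union : Wellformed m ((h₁ ∪S h₂) ∷ hs)
    union = record
      { disjoint  = All.zipWith (uncurry Disjoint-∪S) (d₁ , d₂) ∷ ds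
      ; fresh     = (λ m≤i → ∪S-nothing {h₁} {h₂ = h₂} (f₁ m≤i) (f₂ m≤i)) ∷ fs
      ; ancestral = ∪S-ancestral d₁₂ a₁ a₂ ∷ as
      }

  Wellformed-insert : ∀ {hs g nd} → Wellformed m (h ∷ hs) → g ⊆ᴺ h → (Ancestral h → Ancestral g) →
                      vp nd ≡ nothing → Meld (single m nd) g h' → Wellformed (suc m) (h' ∷ hs)
  Wellformed-insert {m} {h} {h'} {g = g} {nd} wf g⊆h anc-g vp≡ me =
    Wellformed-replace (n≤1+n m) wf (h'⊆h ∘ <⇒≢) fresh'
      (Meld-ancestral disj (single-ancestral vp≡) (anc-g (All.head (ancestral wf))) me)
    where
    disj : Disjoint (single m nd) g
    disj i with if-≡ᵇ i m (just nd) nothing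
    ... | inj₁ (refl , _) = inj₂ (g⊆h m (All.head (fresh wf) ≤-refl))
    ... | inj₂ (_ , e)    = inj₁ e
    h'⊆h : ∀ {i} → i ≢ m → h i ≡ nothing → h' i ≡ nothing
    h'⊆h {i} i≢m hi = Meld-⊆ᴺ disj me i (∪S-nothing {single m nd} {h₂ = g} (single-≢ i≢m) (g⊆h i hi))
    fresh' : Fresh (suc m) h'
    fresh' m<i = h'⊆h (>⇒≢ m<i) (All.head (fresh wf) (<⇒≤ m<i))

  storesOf : State → List Store
  storesOf (mkState _ hs nothing)        = hs
  storesOf (mkState _ hs (just (_ , h))) = h ∷ hs

  Invariant : State → Set c
  Invariant s = Wellformed (next s) (storesOf s)

  Step-preserves-Invariant : ∀ {s s'} → Invariant s → Step s s' → Invariant s'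
  Step-preserves-Invariant {mkState _ hs _} inv make-heap = record
    { disjoint  = All.universal (λ _ _ → inj₁ refl) hs ∷ disjoint inv
    ; fresh     = (λ _ → refl) ∷ fresh inv
    ; ancestral = (λ ()) ∷ ancestral inv
    }
  Step-preserves-Invariant inv (insert _ p me) = Wellformed-insert (Wellformed-↭ inv p) (λ _ → id) id refl me
  Step-preserves-Invariant inv (meld p me) = Wellformed-meld (Wellformed-↭ inv p) me
  Step-preserves-Invariant inv (dec-root _ p (hu , _) _ _) = Wellformed-upd (Wellformed-↭ inv p) hu id inj₁
  Step-preserves-Invariant inv (dec-inner {h = h} {u = u} {n = n} _ p hu _ _ _ me) =
    Wellformed-insert (Wellformed-↭ inv p) dkStore-⊆ᴺ dkStore-ancestral refl me
    where open DecreaseKey h u n _ hu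
  Step-preserves-Invariant inv (del-inner p hu _ _) = Wellformed-upd (Wellformed-↭ inv p) hu id inj₁
  Step-preserves-Invariant inv (del-root p (hu , _) _) = Wellformed-upd (Wellformed-↭ inv p) hu id inj₁
  Step-preserves-Invariant inv (cl-destroy root _) =
    Wellformed-shrink inv destroy-⊆ᴺ (destroy-ancestral (All.head (ancestral inv)) root)
  Step-preserves-Invariant inv (cl-to-rank _) = inv
  Step-preserves-Invariant inv (cl-rlink (hw , _) _ (hl , _) _ w≢l _ _) =
    Wellformed-shrink inv (rlink-⊆ᴺ hw hl w≢l) (rlink-ancestral (All.head (ancestral inv)) hw hl w≢l)
  Step-preserves-Invariant inv (cl-to-unrank _) = inv
  Step-preserves-Invariant inv (cl-ulink _ _ (hl , _) _ _ _) = Wellformed-upd inv hl there inj₁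
  Step-preserves-Invariant inv (cl-done _) = inv

  Reachable⇒Invariant : ∀ {s} → Reachable s → Invariant s
  Reachable⇒Invariant start       = record { disjoint = [] ; fresh = [] ; ancestral = [] }
  Reachable⇒Invariant (step r st) = Step-preserves-Invariant (Reachable⇒Invariant r) st

  StoreOf⇒∈storesOf : ∀ {s} → StoreOf s h → h ∈ storesOf s
  StoreOf⇒∈storesOf {s = mkState _ _ nothing}  (in-heaps h∈) = h∈
  StoreOf⇒∈storesOf {s = mkState _ _ (just _)} (in-heaps h∈) = there h∈
  StoreOf⇒∈storesOf {s = mkState _ _ (just _)} (in-busy refl) = here refl

lemma4p4 : ∀ {c ℓ₁ ℓ₂ : Level} (O : TotalOrder c ℓ₁ ℓ₂) (s : HollowHeaps.State O) →
           HollowHeaps.Reachable O s → HollowHeaps.NoRootHasVP O s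
lemma4p4 O s reachable h u n h∈s root =
  Ancestral⇒root-vp≡nothing
    (All.lookup (Wellformed.ancestral (Reachable⇒Invariant reachable)) (StoreOf⇒∈storesOf h∈s)) root
  where open VirtualParents O
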